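{- Let $C$ be an ordered field, $\mathbb{M}$ a monster model of $T_{\mathrm{Ham}}$ with underlying set $G_\infty$, and $I=I_1+(c)+I_2$ an ordered index set with $I_1,I_2$ infinite. Let $(a_i)_{i\in I}$ be a nonconstant indiscernible sequence from $G$, and let $(b,b')\in G\times v(G)$ be such that $(a_i)_{i\in I_1+I_2}$ is $bb'$-indiscernible. If $v(a_i-b)=b'$ for all $i\neq c$, then $v(a_c-b)=b'$.
   Context: A $2$-ordered $C$-vector space is a $C$-vector space $G$ with two linear orders $<_0,<_1$, each making $G$ an ordered $C$-vector space. Put $G_\infty=G\cup\{\infty\}$ with $\infty$ above $G$ in both orders. A Hamel valuation on $G$ is a map $v:G\to G_\infty$ such that for all $x,y\in G$, $\lambda\in C\setminus\{0\}$: $v(x)=\infty$ iff $x=0$; $v(x+y)\geq_0\min_0(v(x),v(y))$; $v(\lambda x)=v(x)$; if $0<_1x<_1y$ then $v(x)\geq_0v(y)$; $v(v(x))=v(x)$ (with $v(\infty)=\infty$); and $v(x)>_10$. A Hamel space $(G,v)$ is independent if for all $a_0<_0b_0$, $a_1<_1b_1$ in $G\cup\{\pm\infty\}$ there is $z\in G$ with $a_0<_0z<_0b_0$ and $a_1<_1z<_1b_1$; dense if for all $a<_0b$ in $G$ there is $c\in G$ with $a<_0v(c)<_0b$. $T_{\mathrm{Ham}}$ is the complete theory, in the language $\{0,+,(\lambda_c)_{c\in C},<_0,<_1,v,\infty\}$ (structures on $G_\infty$ with $\infty$ as default value), whose models are exactly the independent dense Hamel spaces over $C$. $v(G)$ denotes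 the image of $v$ on $G$. Indiscernible means indiscernible over $\emptyset$ in $\mathbb{M}$. -}

module Defs where

open import Data.Nat as ℕ using (ℕ; suc)
open import Data.Fin as Fin using (Fin)
open import Data.Maybe using (Maybe; just; nothing)
open import Data.Product using (Σ; _×_; _,_; ∃)
open import Data.Sum using (_⊎_; inj₁; inj₂)
open import Data.Unit using (⊤; tt)
open import Data.Empty using (⊥)
open import Relation.Nullary using (¬_)
open import Relation.Binary.PropositionalEquality using (_≡_; _≢_)
open import Relation.Binary.Structures using (IsStrictTotalOrder)
open import Function.Definitions using (Injective)

record OrderedField : Set₁ where
  infixl 6 _+_
  infixl 7 _*_
  infix 4 _<_
  field
    Carrier : Set
    _+_ _*_ : Carrier → Carrier → Carrier
    -_      : Carrier → Carrier
    0# 1#   : Carrier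
    _<_     : Carrier → Carrier → Set
    +-assoc : ∀ x y z → (x + y) + z ≡ x + (y + z)
    +-comm  : ∀ x y → x + y ≡ y + x
    +-idˡ   : ∀ x → 0# + x ≡ x
    -‿invˡ  : ∀ x → (- x) + x ≡ 0#
    *-assoc : ∀ x y z → (x * y) * z ≡ x * (y * z)
    *-comm  : ∀ x y → x * y ≡ y * x
    *-idˡ   : ∀ x → 1# * x ≡ x
    distribˡ : ∀ x y z → x * (y + z) ≡ (x * y) + (x * z)
    0≢1     : 0# ≢ 1#
    *-inv   : ∀ x → x ≢ 0# → Σ Carrier (λ y → y * x ≡ 1#)
    <-isStrictTotalOrder : IsStrictTotalOrder _≡_ _<_
    +-mono-< : ∀ x y z → x < y → x + z < y + z
    *-pos    : ∀ x y → 0# < x → 0# < y → 0# < x * y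

module _ (C : OrderedField) where
  private module C = OrderedField C

  record TwoOrderedVectorSpace : Set₁ where
    infixl 6 _+_
    infix 4 _<₀_ _<₁_
    field
      Carrier : Set
      _+_   : Carrier → Carrier → Carrier
      -_    : Carrier → Carrier
      0#    : Carrier
      _·_   : C.Carrier → Carrier → Carrier
      _<₀_ _<₁_ : Carrier → Carrier → Set
      +-assoc : ∀ x y z → (x + y) + z ≡ x + (y + z)
      +-comm  : ∀ x y → x + y ≡ y + x
      +-idˡ   : ∀ x → 0# + x ≡ x
      -‿invˡ  : ∀ x → (- x) + x ≡ 0#
      ·-assoc : ∀ λ₁ λ₂ x → (λ₁ C.* λ₂) · x ≡ λ₁ · (λ₂ · x)
      ·-id    : ∀ x → C.1# · x ≡ x
      ·-distribˡ : ∀ λ₁ x y → λ₁ · (x + y) ≡ (λ₁ · x) + (λ₁ · y)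
      ·-distribʳ : ∀ λ₁ λ₂ x → (λ₁ C.+ λ₂) · x ≡ (λ₁ · x) + (λ₂ · x)
      <₀-isStrictTotalOrder : IsStrictTotalOrder _≡_ _<₀_
      <₁-isStrictTotalOrder : IsStrictTotalOrder _≡_ _<₁_
      +-mono-<₀ : ∀ x y z → x <₀ y → x + z <₀ y + z
      +-mono-<₁ : ∀ x y z → x <₁ y → x + z <₁ y + z
      ·-pos₀ : ∀ λ₁ x → C._<_ C.0# λ₁ → 0# <₀ x → 0# <₀ λ₁ · x
      ·-pos₁ : ∀ λ₁ x → C._<_ C.0# λ₁ → 0# <₁ x → 0# <₁ λ₁ · x

  module _ (G : TwoOrderedVectorSpace) where
    open TwoOrderedVectorSpace G

    G∞ : Set
    G∞ = Maybe Carrier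

    ∞ : G∞
    ∞ = nothing

    ext< : (Carrier → Carrier → Set) → G∞ → G∞ → Set
    ext< R (just x) (just y) = R x y
    ext< R (just x) nothing  = ⊤
    ext< R nothing  _        = ⊥

    _<₀∞_ _<₁∞_ : G∞ → G∞ → Set
    _<₀∞_ = ext< _<₀_
    _<₁∞_ = ext< _<₁_

    _≤₀∞_ : G∞ → G∞ → Set
    x ≤₀∞ y = (x ≡ y) ⊎ (x <₀∞ y)

    min₀ : G∞ → G∞ → G∞ → Set
    min₀ x y m = (x ≤₀∞ y × m ≡ x) ⊎ (y <₀∞ x × m ≡ y)

    extv : (Carrier → G∞) → G∞ → G∞
    extv v (just x) = v x
    extv v nothing  = nothing

    record IsHamelValuation (v : Carrier → G∞) : Set where
      field
        v-∞     : ∀ x → (v x ≡ ∞ → x ≡ 0#) × (x ≡ 0# → v x ≡ ∞)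
        v-ultra : ∀ x y m → min₀ (v x) (v y) m → m ≤₀∞ v (x + y)
        v-scal  : ∀ λ₁ x → λ₁ ≢ C.0# → v (λ₁ · x) ≡ v x
        v-mono  : ∀ x y → 0# <₁ x → x <₁ y → v y ≤₀∞ v x
        v-idem  : ∀ x → extv v (v x) ≡ v x
        v-pos   : ∀ x → just 0# <₁∞ v x

    -- bounds in G ∪ {±∞}: nothing stands for -∞ (lower) resp. +∞ (upper)
    lowerOK : (Carrier → Carrier → Set) → Maybe Carrier → Carrier → Set
    lowerOK R nothing  z = ⊤
    lowerOK R (just a) z = R a z

    upperOK : (Carrier → Carrier → Set) → Carrier → Maybe Carrier → Set
    upperOK R z nothing  = ⊤
    upperOK R z (just b) = R z b

    boundsOK : (Carrier → Carrier → Set) → Maybe Carrier → Maybe Carrier → Set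
    boundsOK R (just a) (just b) = R a b
    boundsOK R _        _        = ⊤

    Independent : Set
    Independent = ∀ (a₀ b₀ a₁ b₁ : Maybe Carrier) →
      boundsOK _<₀_ a₀ b₀ → boundsOK _<₁_ a₁ b₁ →
      Σ Carrier λ z → lowerOK _<₀_ a₀ z × upperOK _<₀_ z b₀
                    × lowerOK _<₁_ a₁ z × upperOK _<₁_ z b₁

    Dense : (Carrier → G∞) → Set
    Dense v = ∀ a b → a <₀ b →
      Σ Carrier λ c → (just a <₀∞ v c) × (v c <₀∞ just b)

  -- Models of T_Ham: independent dense Hamel spaces over C
  record HamelModel : Set₁ where
    field
      space : TwoOrderedVectorSpace
      v     : TwoOrderedVectorSpace.Carrier space → G∞ space
      isHamel     : IsHamelValuation space v
      independent : Independent space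
      dense       : Dense space v

-- First-order syntax of the language {0,+,(λ_c)_{c∈C},<₀,<₁,v,∞}
-- (negative fragment ⊥, ⇒, ∧, ∀; ¬, ∨, ∃ are definable classically)

module Syntax (C : OrderedField) where
  private module C = OrderedField C

  data Term (n : ℕ) : Set where
    var  : Fin n → Term n
    zero : Term n
    inf  : Term n
    plus : Term n → Term n → Term n
    scal : C.Carrier → Term n → Term n
    val  : Term n → Term n

  data Formula (n : ℕ) : Set where
    eq lt₀ lt₁ : Term n → Term n → Formula n
    falsum : Formula n
    _⇒_ _∧_ : Formula n → Formula n → Formula n
    all : Formula (suc n) → Formula n

  module Semantics (M : HamelModel C) where
    open HamelModel M
    open TwoOrderedVectorSpace space

    D : Set
    D = G∞ C space

    cons : ∀ {n} → D → (Fin n → D) → Fin (suc n) → D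
    cons d ρ Fin.zero    = d
    cons d ρ (Fin.suc i) = ρ i

    -- operations on G_∞ with ∞ as default value
    ⟦_⟧ : ∀ {n} → Term n → (Fin n → D) → D
    ⟦ var i ⟧ ρ = ρ i
    ⟦ zero ⟧ ρ = just 0#
    ⟦ inf ⟧ ρ = nothing
    ⟦ plus s t ⟧ ρ with ⟦ s ⟧ ρ | ⟦ t ⟧ ρ
    ... | just x | just y = just (x + y)
    ... | _      | _      = nothing
    ⟦ scal c t ⟧ ρ with ⟦ t ⟧ ρ
    ... | just x  = just (c · x)
    ... | nothing = nothing
    ⟦ val t ⟧ ρ = extv C space v (⟦ t ⟧ ρ)

    -- classical (double-negation) satisfaction
    Sat : ∀ {n} → Formula n → (Fin n → D) → Set
    Sat (eq s t)  ρ = ¬ ¬ (⟦ s ⟧ ρ ≡ ⟦ t ⟧ ρ)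
    Sat (lt₀ s t) ρ = ¬ ¬ (_<₀∞_ C space (⟦ s ⟧ ρ) (⟦ t ⟧ ρ))
    Sat (lt₁ s t) ρ = ¬ ¬ (_<₁∞_ C space (⟦ s ⟧ ρ) (⟦ t ⟧ ρ))
    Sat falsum    ρ = ⊥
    Sat (φ ⇒ ψ)   ρ = Sat φ ρ → Sat ψ ρ
    Sat (φ ∧ ψ)   ρ = Sat φ ρ × Sat ψ ρ
    Sat (all φ)   ρ = ∀ d → Sat φ (cons d ρ)

    append : ∀ {k n} → (Fin k → D) → (Fin n → D) → Fin (k ℕ.+ n) → D
    append {ℕ.zero}  p ρ i           = ρ i
    append {suc k}   p ρ Fin.zero    = p Fin.zero
    append {suc k}   p ρ (Fin.suc i) = append (λ j → p (Fin.suc j)) ρ i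

    IndiscernibleOver : ∀ {k} (p : Fin k → D) {J : Set} (_≺_ : J → J → Set)
                        (a : J → D) → Set
    IndiscernibleOver {k} p {J} _≺_ a =
      ∀ n (φ : Formula (k ℕ.+ n)) (f g : Fin n → J) →
      (∀ i j → i Fin.< j → f i ≺ f j) → (∀ i j → i Fin.< j → g i ≺ g j) →
      (Sat φ (append p (λ i → a (f i))) → Sat φ (append p (λ i → a (g i))))
      × (Sat φ (append p (λ i → a (g i))) → Sat φ (append p (λ i → a (f i))))

    noParams : Fin 0 → D
    noParams ()

record LinearOrder : Set₁ where
  field
    Carrier : Set
    _<_     : Carrier → Carrier → Set
    isStrictTotalOrder : IsStrictTotalOrder _≡_ _<_

Infinite : Set → Set
Infinite A = Σ (ℕ → A) Injective′
  where Injective′ : (ℕ → A) → Set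
        Injective′ f = Injective _≡_ _≡_ f

module _ (I₁ I₂ : LinearOrder) where
  private
    module I₁ = LinearOrder I₁
    module I₂ = LinearOrder I₂

  Idx : Set
  Idx = I₁.Carrier ⊎ (⊤ ⊎ I₂.Carrier)

  cIdx : Idx
  cIdx = inj₂ (inj₁ tt)

  _≺_ : Idx → Idx → Set
  inj₁ x ≺ inj₁ y = x I₁.< y
  inj₁ x ≺ inj₂ _ = ⊤
  inj₂ _ ≺ inj₁ _ = ⊥
  inj₂ (inj₁ _) ≺ inj₂ (inj₁ _) = ⊥
  inj₂ (inj₁ _) ≺ inj₂ (inj₂ _) = ⊤
  inj₂ (inj₂ _) ≺ inj₂ (inj₁ _) = ⊥
  inj₂ (inj₂ x) ≺ inj₂ (inj₂ y) = x I₂.< y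

  Idx⁻ : Set
  Idx⁻ = I₁.Carrier ⊎ I₂.Carrier

  emb : Idx⁻ → Idx
  emb (inj₁ x) = inj₁ x
  emb (inj₂ y) = inj₂ (inj₂ y)

  _≺⁻_ : Idx⁻ → Idx⁻ → Set
  x ≺⁻ y = emb x ≺ emb y

-- Let u = v(a_c − b). If u < b′, then for i < j in I₁ the ultrametric inequality gives
-- v(a_i − a_c) = u < b′ ≤ v(a_i − a_j); indiscernibility carries this from (i, j, c) to
-- (i, c, k) with k in I₂, so v(a_i − a_k) < u, whereas v(a_i − a_k) ≥ b′.
-- If u > b′, every a_i with i ≠ c is farther from b than a_c is, so, v being <₁-antitone on
-- positive elements, a_i lies on the same <₁-side of b as of a_c. By indiscernibility a_c lies
-- <₁-between the a_i with i in I₁ and those with i in I₂, so these lie on opposite sides of b,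
-- contradicting the bb′-indiscernibility of (a_i)_{i ≠ c}.

module Submission where

open import Defs
open import Algebra.Bundles using (AbelianGroup)
import Algebra.Properties.AbelianGroup as AbelianGroupProperties
open import Data.Empty using (⊥; ⊥-elim)
open import Data.Fin as Fin using (Fin; zero; suc; #_)
open import Data.Nat using (s≤s)
open import Data.Maybe using (just; nothing)
open import Data.Maybe.Properties using (just-injective)
open import Data.Product using (Σ; _×_; _,_; proj₁; proj₂)
open import Data.Sum using (_⊎_; inj₁; inj₂)
open import Data.Unit using (tt)
open import Data.Vec.Functional using ([]; _∷_)
open import Function using (_∘_)
open import Level using (0ℓ)
open import Relation.Binary.Definitions using (Tri; Trichotomous; tri<; tri≈; tri>)
open import Relation.Binary.PropositionalEquality
  using (_≡_; _≢_; refl; sym; trans; cong; cong₂; subst; subst₂; isEquivalence;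
         module ≡-Reasoning)
open import Relation.Binary.Structures using (IsStrictTotalOrder)
open import Relation.Nullary using (¬_)
open import Relation.Nullary.Negation using (contradiction; ¬¬-map)

module ExtendedOrder {C : OrderedField} (G : TwoOrderedVectorSpace C) where
  open TwoOrderedVectorSpace G

  ext<-isStrictTotalOrder : ∀ {R} → IsStrictTotalOrder _≡_ R →
                            IsStrictTotalOrder _≡_ (ext< C G R)
  ext<-isStrictTotalOrder {R} sto = record
    { isStrictPartialOrder = record
      { isEquivalence = isEquivalence
      ; irrefl        = λ {x} {y} → irrefl∞ {x} {y}
      ; trans         = λ {x} {y} {z} → trans∞ {x} {y} {z}
      ; <-resp-≈      = (λ { refl r → r }) , (λ { refl r → r })
      }
    ; compare = compare∞
    }
    where
      open IsStrictTotalOrder sto using (irrefl; compare) renaming (trans to <-trans)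
      irrefl∞ : ∀ {x y} → x ≡ y → ext< C G R x y → ⊥
      irrefl∞ {just x} refl r = irrefl refl r

      trans∞ : ∀ {x y z} → ext< C G R x y → ext< C G R y z → ext< C G R x z
      trans∞ {just x} {just y} {just z} r s = <-trans r s
      trans∞ {just x} {just y} {nothing} r s = tt

      compare∞ : Trichotomous _≡_ (ext< C G R)
      compare∞ (just x) (just y) with compare x y
      ... | tri< r ¬e ¬s = tri< r (¬e ∘ just-injective) ¬s
      ... | tri≈ ¬r refl ¬s = tri≈ ¬r refl ¬s
      ... | tri> ¬r ¬e s = tri> ¬r (¬e ∘ just-injective) s
      compare∞ (just x) nothing  = tri< tt (λ ()) (λ ())
      compare∞ nothing  (just y) = tri> (λ ()) (λ ()) tt
      compare∞ nothing  nothing  = tri≈ (λ ()) refl (λ ())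

  module <₀∞ = IsStrictTotalOrder (ext<-isStrictTotalOrder <₀-isStrictTotalOrder)

  _<∞_ _≤∞_ : G∞ C G → G∞ C G → Set
  _<∞_ = _<₀∞_ C G
  _≤∞_ = _≤₀∞_ C G

  ≤∞-trans : ∀ {x y z} → x ≤∞ y → y ≤∞ z → x ≤∞ z
  ≤∞-trans (inj₁ refl) q = q
  ≤∞-trans (inj₂ p) (inj₁ refl) = inj₂ p
  ≤∞-trans {x} {y} {z} (inj₂ p) (inj₂ q) = inj₂ (<₀∞.trans {x} {y} {z} p q)

  ≤-<∞-trans : ∀ {x y z} → x ≤∞ y → y <∞ z → x <∞ z
  ≤-<∞-trans (inj₁ refl) q = q
  ≤-<∞-trans {x} {y} {z} (inj₂ p) q = <₀∞.trans {x} {y} {z} p q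

  <-≤∞-trans : ∀ {x y z} → x <∞ y → y ≤∞ z → x <∞ z
  <-≤∞-trans p (inj₁ refl) = p
  <-≤∞-trans {x} {y} {z} p (inj₂ q) = <₀∞.trans {x} {y} {z} p q

  min₀-exists : ∀ x y → Σ (G∞ C G) (min₀ C G x y)
  min₀-exists x y with <₀∞.compare x y
  ... | tri< x<y _ _ = x , inj₁ (inj₂ x<y , refl)
  ... | tri≈ _ x≡y _ = x , inj₁ (inj₁ x≡y , refl)
  ... | tri> _ _ y<x = y , inj₂ (y<x , refl)

  min₀-either : ∀ {x y m} → min₀ C G x y m → m ≡ x ⊎ m ≡ y
  min₀-either (inj₁ (_ , m≡x)) = inj₁ m≡x
  min₀-either (inj₂ (_ , m≡y)) = inj₂ m≡y

module VectorSpaceProperties {C : OrderedField} (G : TwoOrderedVectorSpace C) where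
  open TwoOrderedVectorSpace G
  private module C = OrderedField C

  infixl 6 _-_
  _-_ : Carrier → Carrier → Carrier
  x - y = x + - y

  +-abelianGroup : AbelianGroup 0ℓ 0ℓ
  +-abelianGroup = record
    { isAbelianGroup = record
      { isGroup = record
        { isMonoid = record
          { isSemigroup = record
            { isMagma = record { isEquivalence = isEquivalence ; ∙-cong = cong₂ _+_ }
            ; assoc   = +-assoc
            }
          ; identity = +-idˡ , λ x → trans (+-comm x 0#) (+-idˡ x)
          }
        ; inverse = -‿invˡ , λ x → trans (+-comm x (- x)) (-‿invˡ x)
        ; ⁻¹-cong = cong (λ x → - x)
        }
      ; comm = +-comm
      }
    }

  open AbelianGroupProperties +-abelianGroup
    using (identityˡ-unique; inverseˡ-unique; ⁻¹-anti-homo‿-;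
           \\-leftDividesˡ; //-rightDividesʳ)
  open AbelianGroupProperties +-abelianGroup public
    using () renaming (ε⁻¹≈ε to -0≡0; ⁻¹-involutive to -‿involutive)
  open AbelianGroup +-abelianGroup using (inverseʳ)
  open ≡-Reasoning

  x-x≡0 : ∀ x → x - x ≡ 0#
  x-x≡0 = inverseʳ

  [x+y]-y≡x : ∀ x y → (x + y) - y ≡ x
  [x+y]-y≡x x y = //-rightDividesʳ y x

  x+[-x+y]≡y : ∀ x y → x + (- x + y) ≡ y
  x+[-x+y]≡y = \\-leftDividesˡ

  [x-z]-[y-z]≡x-y : ∀ x y z → (x - z) - (y - z) ≡ x - y
  [x-z]-[y-z]≡x-y x y z = begin
    (x - z) - (y - z)     ≡⟨ cong ((x - z) +_) (⁻¹-anti-homo‿- y z) ⟩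
    (x - z) + (z - y)     ≡⟨ +-assoc x (- z) (z - y) ⟩
    x + (- z + (z - y))   ≡⟨ cong (x +_) (sym (+-assoc (- z) z (- y))) ⟩
    x + ((- z + z) - y)   ≡⟨ cong (λ t → x + (t - y)) (-‿invˡ z) ⟩
    x + (0# - y)          ≡⟨ cong (x +_) (+-idˡ (- y)) ⟩
    x - y                 ∎

  0·x≡0 : ∀ x → C.0# · x ≡ 0#
  0·x≡0 x = identityˡ-unique (C.0# · x) (C.0# · x) (begin
    C.0# · x + C.0# · x   ≡⟨ sym (·-distribʳ C.0# C.0# x) ⟩
    (C.0# C.+ C.0#) · x   ≡⟨ cong (_· x) (C.+-idˡ C.0#) ⟩
    C.0# · x              ∎)

  -1·x≡-x : ∀ x → (C.- C.1#) · x ≡ - x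
  -1·x≡-x x = inverseˡ-unique ((C.- C.1#) · x) x (begin
    (C.- C.1#) · x + x          ≡⟨ cong ((C.- C.1#) · x +_) (sym (·-id x)) ⟩
    (C.- C.1#) · x + C.1# · x   ≡⟨ sym (·-distribʳ (C.- C.1#) C.1# x) ⟩
    (C.- C.1# C.+ C.1#) · x     ≡⟨ cong (_· x) (C.-‿invˡ C.1#) ⟩
    C.0# · x                    ≡⟨ 0·x≡0 x ⟩
    0#                          ∎)

  -1≢0 : C.- C.1# ≢ C.0#
  -1≢0 -1≡0 = C.0≢1 (begin
    C.0#             ≡⟨ sym (C.-‿invˡ C.1#) ⟩
    C.- C.1# C.+ C.1# ≡⟨ cong (C._+ C.1#) -1≡0 ⟩
    C.0# C.+ C.1#     ≡⟨ C.+-idˡ C.1# ⟩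
    C.1#              ∎)

  +-cancelʳ-<₁ : ∀ x y z → x + z <₁ y + z → x <₁ y
  +-cancelʳ-<₁ x y z x+z<y+z =
    subst₂ _<₁_ ([x+y]-y≡x x z) ([x+y]-y≡x y z) (+-mono-<₁ _ _ (- z) x+z<y+z)

  -‿antitone-<₁ : ∀ x y → x <₁ y → - y <₁ - x
  -‿antitone-<₁ x y x<y = subst₂ _<₁_ (x+[-x+y]≡y x (- y)) y+[-x-y]≡-x
    (+-mono-<₁ x y (- x - y) x<y)
    where
      y+[-x-y]≡-x : y + (- x - y) ≡ - x
      y+[-x-y]≡-x = trans (cong (y +_) (+-comm (- x) (- y))) (x+[-x+y]≡y y (- x))

module ValuationProperties {C : OrderedField} {G : TwoOrderedVectorSpace C}
  {v : TwoOrderedVectorSpace.Carrier G → G∞ C G} (isHamel : IsHamelValuation C G v) where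
  open TwoOrderedVectorSpace G
  open IsHamelValuation isHamel
  open ExtendedOrder G
  open VectorSpaceProperties G
  open ≡-Reasoning
  private module <₁ = IsStrictTotalOrder <₁-isStrictTotalOrder

  v0≡∞ : v 0# ≡ ∞ C G
  v0≡∞ = proj₂ (v-∞ 0#) refl

  v-neg : ∀ x → v (- x) ≡ v x
  v-neg x = trans (cong v (sym (-1·x≡-x x))) (v-scal _ x -1≢0)

  ultra-witness : ∀ x y → Σ (G∞ C G) λ m → (m ≡ v x ⊎ m ≡ v y) × m ≤∞ v (x + y)
  ultra-witness x y with min₀-exists (v x) (v y)
  ... | m , isMin = m , min₀-either isMin , v-ultra x y m isMin

  v-+-≥ : ∀ {w} x y → w ≤∞ v x → w ≤∞ v y → w ≤∞ v (x + y)
  v-+-≥ {w} x y w≤vx w≤vy with ultra-witness x y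
  ... | m , inj₁ refl , m≤v[x+y] = ≤∞-trans {w} {m} w≤vx m≤v[x+y]
  ... | m , inj₂ refl , m≤v[x+y] = ≤∞-trans {w} {m} w≤vy m≤v[x+y]

  v-+-> : ∀ {w} x y → w <∞ v x → w <∞ v y → w <∞ v (x + y)
  v-+-> {w} x y w<vx w<vy with ultra-witness x y
  ... | m , inj₁ refl , m≤v[x+y] = <-≤∞-trans {w} {m} w<vx m≤v[x+y]
  ... | m , inj₂ refl , m≤v[x+y] = <-≤∞-trans {w} {m} w<vy m≤v[x+y]

  v-+-dominant : ∀ x y → v x <∞ v y → v (x + y) ≡ v x
  v-+-dominant x y vx<vy with v-+-≥ x y (inj₁ refl) (inj₂ vx<vy)
  ... | inj₁ vx≡v[x+y] = sym vx≡v[x+y]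
  ... | inj₂ vx<v[x+y] = ⊥-elim (<₀∞.irrefl {v x} refl
    (subst (v x <∞_) (cong v ([x+y]-y≡x x y))
      (v-+-> {v x} (x + y) (- y) vx<v[x+y] (subst (v x <∞_) (sym (v-neg y)) vx<vy))))

  v-sub-≥ : ∀ {w} x y z → w ≤∞ v (x - z) → w ≤∞ v (y - z) → w ≤∞ v (x - y)
  v-sub-≥ {w} x y z w≤v[x-z] w≤v[y-z] = subst (λ t → w ≤∞ v t) ([x-z]-[y-z]≡x-y x y z)
    (v-+-≥ (x - z) (- (y - z)) w≤v[x-z] (subst (w ≤∞_) (sym (v-neg (y - z))) w≤v[y-z]))

  v-sub-dominant : ∀ x y z → v (y - z) <∞ v (x - z) → v (x - y) ≡ v (y - z)
  v-sub-dominant x y z v[y-z]<v[x-z] = begin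
    v (x - y)                ≡⟨ cong v (sym ([x-z]-[y-z]≡x-y x y z)) ⟩
    v ((x - z) - (y - z))    ≡⟨ cong v (+-comm (x - z) (- (y - z))) ⟩
    v (- (y - z) + (x - z))  ≡⟨ v-+-dominant (- (y - z)) (x - z)
                                  (subst (_<∞ v (x - z)) (sym (v-neg (y - z))) v[y-z]<v[x-z]) ⟩
    v (- (y - z))            ≡⟨ v-neg (y - z) ⟩
    v (y - z)                ∎

  x<₁y⇒x<₁0 : ∀ x y → v x <∞ v y → x <₁ y → x <₁ 0#
  x<₁y⇒x<₁0 x y vx<vy x<y with <₁.compare x 0#
  ... | tri< x<0 _ _ = x<0
  ... | tri≈ _ refl _ = ⊥-elim (subst (_<∞ v y) v0≡∞ vx<vy)
  ... | tri> _ _ 0<x = ⊥-elim (<₀∞.irrefl {v y} refl (≤-<∞-trans (v-mono x y 0<x x<y) vx<vy))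

  y<₁x⇒0<₁x : ∀ x y → v x <∞ v y → y <₁ x → 0# <₁ x
  y<₁x⇒0<₁x x y vx<vy y<x = subst₂ _<₁_ -0≡0 (-‿involutive x) (-‿antitone-<₁ (- x) 0# -x<0)
    where
      -x<0 : - x <₁ 0#
      -x<0 = x<₁y⇒x<₁0 (- x) (- y) (subst₂ _<∞_ (sym (v-neg x)) (sym (v-neg y)) vx<vy)
                        (-‿antitone-<₁ y x y<x)

  x<₁y⇒x<₁b : ∀ b x y → v (x - b) <∞ v (y - b) → x <₁ y → x <₁ b
  x<₁y⇒x<₁b b x y v[x-b]<v[y-b] x<y = +-cancelʳ-<₁ x b (- b)
    (subst (x - b <₁_) (sym (x-x≡0 b))
      (x<₁y⇒x<₁0 (x - b) (y - b) v[x-b]<v[y-b] (+-mono-<₁ x y (- b) x<y)))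

  y<₁x⇒b<₁x : ∀ b x y → v (x - b) <∞ v (y - b) → y <₁ x → b <₁ x
  y<₁x⇒b<₁x b x y v[x-b]<v[y-b] y<x = +-cancelʳ-<₁ b x (- b)
    (subst (_<₁ x - b) (sym (x-x≡0 b))
      (y<₁x⇒0<₁x (x - b) (y - b) v[x-b]<v[y-b] (+-mono-<₁ y x (- b) y<x)))

Increasing : ∀ {J : Set} → (J → J → Set) → ∀ {n} → (Fin n → J) → Set
Increasing _≺_ f = ∀ i j → i Fin.< j → f i ≺ f j

module _ {J : Set} (_≺_ : J → J → Set) where

  singleton-increasing : ∀ {x} → Increasing _≺_ (x ∷ [])
  singleton-increasing zero zero ()

  pair-increasing : ∀ {x y} → x ≺ y → Increasing _≺_ (x ∷ y ∷ [])
  pair-increasing x≺y zero       (suc zero) _ = x≺y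
  pair-increasing x≺y zero       zero       ()
  pair-increasing x≺y (suc zero) zero       ()
  pair-increasing x≺y (suc zero) (suc zero) (s≤s ())

  triple-increasing : ∀ {x y z} → x ≺ y → y ≺ z → x ≺ z →
                      Increasing _≺_ (x ∷ y ∷ z ∷ [])
  triple-increasing x≺y y≺z x≺z zero             (suc zero)       _ = x≺y
  triple-increasing x≺y y≺z x≺z zero             (suc (suc zero)) _ = x≺z
  triple-increasing x≺y y≺z x≺z (suc zero)       (suc (suc zero)) _ = y≺z
  triple-increasing x≺y y≺z x≺z zero             zero             ()
  triple-increasing x≺y y≺z x≺z (suc zero)       zero             ()
  triple-increasing x≺y y≺z x≺z (suc zero)       (suc zero)       (s≤s ())
  triple-increasing x≺y y≺z x≺z (suc (suc zero)) zero             ()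
  triple-increasing x≺y y≺z x≺z (suc (suc zero)) (suc zero)       (s≤s ())
  triple-increasing x≺y y≺z x≺z (suc (suc zero)) (suc (suc zero)) (s≤s (s≤s ()))

module _ {C : OrderedField} where
  open Syntax C
  private module C = OrderedField C

  infixl 6 _⊖_
  _⊖_ : ∀ {n} → Term n → Term n → Term n
  s ⊖ t = plus s (scal (C.- C.1#) t)

infinite-has-< : (I : LinearOrder) → let open LinearOrder I in
                 Infinite Carrier → Σ Carrier λ i → Σ Carrier λ j → i < j
infinite-has-< I (f , f-injective) with IsStrictTotalOrder.compare isStrictTotalOrder (f 0) (f 1)
  where open LinearOrder I
... | tri< f0<f1 _ _ = f 0 , f 1 , f0<f1
... | tri≈ _ f0≡f1 _ = ⊥-elim (0≢1 (f-injective f0≡f1))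
  where
    0≢1 : 0 ≡ 1 → ⊥
    0≢1 ()
... | tri> _ _ f1<f0 = f 1 , f 0 , f1<f0

module _ {C : OrderedField} (M : HamelModel C) (I₁ I₂ : LinearOrder) where
  open HamelModel M
  open TwoOrderedVectorSpace space
  open Syntax C
  open Syntax.Semantics C M
  open ExtendedOrder space
  open VectorSpaceProperties space
  open ValuationProperties isHamel
  private
    module C = OrderedField C
    module I₁ = LinearOrder I₁
    module I₂ = LinearOrder I₂
    module <₁ = IsStrictTotalOrder <₁-isStrictTotalOrder

  v[x⊖y]≡v[x-y] : ∀ x y → v (x + (C.- C.1#) · y) ≡ v (x - y)
  v[x⊖y]≡v[x-y] x y = cong (λ t → v (x + t)) (-1·x≡-x y)

  module _ (a : Idx I₁ I₂ → Carrier) (b : Carrier) (b′ : D)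
           (ind : IndiscernibleOver noParams (_≺_ I₁ I₂) (λ i → just (a i)))
           (v[a-b]≡b′ : ∀ i → v (a (emb I₁ I₂ i) - b) ≡ b′) where

    private
      c : Idx I₁ I₂
      c = cIdx I₁ I₂

    v[a-c-b]≮b′ : ∀ {i j} → i I₁.< j → I₂.Carrier → ¬ (v (a c - b) <∞ b′)
    v[a-c-b]≮b′ {i} {j} i<j k u<b′ = transfer before λ after →
      <₀∞.irrefl {b′} refl
        (≤-<∞-trans {b′} (b′≤v[aᵢ-x] aₖ (v[a-b]≡b′ (inj₂ k)))
          (<₀∞.trans {v (aᵢ - aₖ)} (subst (v (aᵢ - aₖ) <∞_) v[aᵢ-c]≡u after) u<b′))
      where
        aᵢ aⱼ aₖ : Carrier
        aᵢ = a (inj₁ i)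
        aⱼ = a (inj₁ j)
        aₖ = a (inj₂ (inj₂ k))

        v[aᵢ-c]≡u : v (aᵢ - a c) ≡ v (a c - b)
        v[aᵢ-c]≡u = v-sub-dominant aᵢ (a c) b
                      (subst (v (a c - b) <∞_) (sym (v[a-b]≡b′ (inj₁ i))) u<b′)

        b′≤v[aᵢ-x] : ∀ x → v (x - b) ≡ b′ → b′ ≤∞ v (aᵢ - x)
        b′≤v[aᵢ-x] x v[x-b]≡b′ =
          v-sub-≥ aᵢ x b (inj₁ (sym (v[a-b]≡b′ (inj₁ i)))) (inj₁ (sym v[x-b]≡b′))

        before : v (aᵢ - a c) <∞ v (aᵢ - aⱼ)
        before = <-≤∞-trans {v (aᵢ - a c)} (subst (_<∞ b′) (sym v[aᵢ-c]≡u) u<b′)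
                                           (b′≤v[aᵢ-x] aⱼ (v[a-b]≡b′ (inj₁ j)))

        transfer : v (aᵢ - a c) <∞ v (aᵢ - aⱼ) → ¬ ¬ (v (aᵢ - aₖ) <∞ v (aᵢ - a c))
        transfer v[aᵢ-c]<v[aᵢ-aⱼ] =
          ¬¬-map (subst₂ _<∞_ (v[x⊖y]≡v[x-y] aᵢ aₖ) (v[x⊖y]≡v[x-y] aᵢ (a c)))
            (proj₁ (ind 3 (lt₀ (val (var (# 0) ⊖ var (# 2))) (val (var (# 0) ⊖ var (# 1))))
                          (inj₁ i ∷ inj₁ j ∷ c ∷ []) (inj₁ i ∷ c ∷ inj₂ (inj₂ k) ∷ [])
                          (triple-increasing (_≺_ I₁ I₂) i<j tt tt)
                          (triple-increasing (_≺_ I₁ I₂) tt tt tt))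
              (contradiction (subst₂ _<∞_ (sym (v[x⊖y]≡v[x-y] aᵢ (a c)))
                                          (sym (v[x⊖y]≡v[x-y] aᵢ aⱼ))
                                          v[aᵢ-c]<v[aᵢ-aⱼ])))

    b′≮v[a-c-b] : I₁.Carrier → I₂.Carrier →
      IndiscernibleOver (cons (just b) (cons b′ noParams)) (_≺⁻_ I₁ I₂)
        (λ i → just (a (emb I₁ I₂ i))) →
      ¬ (b′ <∞ v (a c - b))
    b′≮v[a-c-b] i k ind′ b′<u = by-cases (<₁.compare aᵢ (a c))
      where
        aᵢ aₖ : Carrier
        aᵢ = a (inj₁ i)
        aₖ = a (inj₂ (inj₂ k))

        far : ∀ x → v (a (emb I₁ I₂ x) - b) <∞ v (a c - b)
        far x = subst (_<∞ v (a c - b)) (sym (v[a-b]≡b′ x)) b′<u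

        shift-i-c-to-c-k : (φ : Formula 2) → Sat φ (λ n → just (a ((inj₁ i ∷ c ∷ []) n))) →
                           Sat φ (λ n → just (a ((c ∷ inj₂ (inj₂ k) ∷ []) n)))
        shift-i-c-to-c-k φ = proj₁ (ind 2 φ (inj₁ i ∷ c ∷ []) (c ∷ inj₂ (inj₂ k) ∷ [])
                                      (pair-increasing (_≺_ I₁ I₂) tt)
                                      (pair-increasing (_≺_ I₁ I₂) tt))

        c-above : aᵢ <₁ a c → ¬ ¬ (a c <₁ aₖ)
        c-above aᵢ<c = shift-i-c-to-c-k (lt₁ (var (# 0)) (var (# 1))) (contradiction aᵢ<c)

        c-below : a c <₁ aᵢ → ¬ ¬ (aₖ <₁ a c)
        c-below c<aᵢ = shift-i-c-to-c-k (lt₁ (var (# 1)) (var (# 0))) (contradiction c<aᵢ)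

        same-side-of-b : (¬ ¬ (aᵢ <₁ b) → ¬ ¬ (aₖ <₁ b)) × (¬ ¬ (aₖ <₁ b) → ¬ ¬ (aᵢ <₁ b))
        same-side-of-b = ind′ 1 (lt₁ (var (# 2)) (var (# 0))) (inj₁ i ∷ []) (inj₂ k ∷ [])
                              (singleton-increasing (_≺⁻_ I₁ I₂))
                              (singleton-increasing (_≺⁻_ I₁ I₂))

        by-cases : Tri (aᵢ <₁ a c) (aᵢ ≡ a c) (a c <₁ aᵢ) → ⊥
        by-cases (tri< aᵢ<c _ _) = c-above aᵢ<c λ c<aₖ →
          proj₁ same-side-of-b (contradiction (x<₁y⇒x<₁b b aᵢ (a c) (far (inj₁ i)) aᵢ<c))
          λ aₖ<b →
          <₁.asym aₖ<b (y<₁x⇒b<₁x b aₖ (a c) (far (inj₂ k)) c<aₖ)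
        by-cases (tri≈ _ aᵢ≡c _) =
          <₀∞.irrefl {v (a c - b)} refl
            (subst (λ x → v (x - b) <∞ v (a c - b)) aᵢ≡c (far (inj₁ i)))
        by-cases (tri> _ _ c<aᵢ) = c-below c<aᵢ λ aₖ<c →
          proj₂ same-side-of-b (contradiction (x<₁y⇒x<₁b b aₖ (a c) (far (inj₂ k)) aₖ<c))
          λ aᵢ<b →
          <₁.asym aᵢ<b (y<₁x⇒b<₁x b aᵢ (a c) (far (inj₁ i)) c<aᵢ)

lemma5p4 : (C : OrderedField) (M : HamelModel C) →
    let open HamelModel M
        open TwoOrderedVectorSpace space
        open Syntax.Semantics C M
    in (I₁ I₂ : LinearOrder) →
       Infinite (LinearOrder.Carrier I₁) → Infinite (LinearOrder.Carrier I₂) →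
       (a : Idx I₁ I₂ → Carrier) →
       Σ (Idx I₁ I₂) (λ i → Σ (Idx I₁ I₂) (λ j → a i ≢ a j)) →
       IndiscernibleOver noParams (_≺_ I₁ I₂) (λ i → just (a i)) →
       (b : Carrier) (b′ : D) → Σ Carrier (λ x → v x ≡ b′) →
       IndiscernibleOver (cons (just b) (cons b′ noParams)) (_≺⁻_ I₁ I₂)
         (λ i → just (a (emb I₁ I₂ i))) →
       (∀ i → v (a (emb I₁ I₂ i) + - b) ≡ b′) →
       v (a (cIdx I₁ I₂) + - b) ≡ b′
lemma5p4 C M I₁ I₂ I₁-infinite I₂-infinite a _ ind b b′ _ ind′ v[a-b]≡b′
  with ExtendedOrder.<₀∞.compare space (v (a (cIdx I₁ I₂) + - b)) b′
     | infinite-has-< I₁ I₁-infinite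
  where open HamelModel M
        open TwoOrderedVectorSpace space
... | tri< u<b′ _ _ | _ , _ , i<j =
  ⊥-elim (v[a-c-b]≮b′ M I₁ I₂ a b b′ ind v[a-b]≡b′ i<j (proj₁ I₂-infinite 0) u<b′)
... | tri≈ _ u≡b′ _ | _ = u≡b′
... | tri> _ _ b′<u | i , _ =
  ⊥-elim (b′≮v[a-c-b] M I₁ I₂ a b b′ ind v[a-b]≡b′ i (proj₁ I₂-infinite 0) ind′ b′<u)
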